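{- Suppose that $M \in \mathsf{RMatrices}$ with $\dim(M)=d$, and write $m_{ij}$ for the entry of $M$ in row $i$ and column $j$. Then \[ f_{\mathsf{MA}}(M) = (0^{m_{11}},1^{m_{22}},0^{m_{12}}, 2^{m_{33}},1^{m_{23}},0^{m_{13}},\ldots,(d-1)^{m_{dd}},(d-2)^{m_{d-1\,d}},\ldots,0^{m_{1d}}), \] where $i^j$ denotes a sequence of $j$ copies of $i$.
   Context: $\mathsf{Matrices}_n$ is the set of upper-triangular square matrices with non-negative integer entries summing to $n$ having no row and no column consisting only of zeros; $\mathsf{RMatrices}_n$ is the subset of those all of whose diagonal entries are positive. For a matrix $M$, $\mathsf{mindex}(M)$ is the lowest index of a row whose rightmost entry is non-zero, and $\mathsf{rowsum}_i(M)$ is the sum of row $i$. For $M\in\mathsf{Matrices}_n$ define $\mathsf{reduce}(M)\in\mathsf{Matrices}_{n-1}$ by: (MA1) if $\mathsf{rowsum}_{\mathsf{mindex}(M)}(M)>1$, decrease the entry at $(\mathsf{mindex}(M),\dim(M))$ by one; (MA2) if $\mathsf{rowsum}_{\mathsf{mindex}(M)}(M)=1$ and $\mathsf{mindex}(M)=\dim(M)$, delete the last row and column; (MA3) if $\mathsf{rowsum}_{\mathsf{mindex}(M)}(M)=1$ and $\mathsf{mindex}(M)<\dim(M)$, for $j\in[1,\mathsf{mindex}(M))$ move the entry at $(j,\mathsf{mindex}(M))$ to $(j,\dim(M))$, then delete row and column $\mathsf{mindex}(M)$. Set $M^{(n)}=M$, $M^{(k)}=\mathsf{reduce}(M^{(k+1)})$,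 $a_k=\mathsf{mindex}(M^{(k)})-1$; the bijection $f_{\mathsf{MA}}$ from $\mathsf{Matrices}_n$ to ascent sequences of length $n$ is $f_{\mathsf{MA}}(M)=(a_1,\ldots,a_n)$. -}

module Defs where

open import Data.Nat using (ℕ; zero; suc; _<_; _≤_; _≟_; _<?_; _≤?_; pred)
open import Data.Fin as Fin using (Fin; toℕ; punchIn; inject₁; fromℕ)
open import Data.Nat.ListAction using (sum)
open import Data.List using (List; []; _∷_; _++_; [_]; map; concatMap; replicate; filter; reverse)
open import Data.List.Base using (allFin)
open import Data.Maybe using (Maybe; just; nothing)
import Data.Maybe as Maybe
open import Data.Product using (Σ; ∃; _,_; _×_)
open import Relation.Nullary using (yes; no; ¬_)
open import Relation.Binary.PropositionalEquality using (_≡_)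
open import Function using (_∘_)

-- A square d×d matrix of natural numbers; rows/columns indexed 0..d-1
-- (row i here is row i+1 of the paper).
Mat : ℕ → Set
Mat d = Fin d → Fin d → ℕ

rowsum : ∀ {d} → Mat d → Fin d → ℕ
rowsum {d} M i = sum (map (M i) (allFin d))

colsum : ∀ {d} → Mat d → Fin d → ℕ
colsum {d} M j = sum (map (λ i → M i j) (allFin d))

total : ∀ {d} → Mat d → ℕ
total {d} M = sum (map (rowsum M) (allFin d))

record IsMatrix (n d : ℕ) (M : Mat d) : Set where
  field
    upper   : ∀ i j → toℕ j < toℕ i → M i j ≡ 0
    sumIs   : total M ≡ n
    noZeroRow : ∀ i → ¬ (rowsum M i ≡ 0)
    noZeroCol : ∀ j → ¬ (colsum M j ≡ 0)

record IsRMatrix (n d : ℕ) (M : Mat d) : Set where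
  field
    isMatrix : IsMatrix n d M
    diagPos  : ∀ i → 0 < M i i

firstNZ : ∀ {n} → (Fin n → ℕ) → Maybe (Fin n)
firstNZ {zero} f = nothing
firstNZ {suc n} f with f Fin.zero
... | suc _ = just Fin.zero
... | zero = Maybe.map Fin.suc (firstNZ (f ∘ Fin.suc))

mindex : ∀ {d} → Mat d → Maybe (Fin d)
mindex {zero} M = nothing
mindex {suc k} M = firstNZ (λ i → M i (fromℕ k))

-- the map reduce (defaults on inputs that are not in Matrices are irrelevant)
reduce : (d : ℕ) → Mat d → Σ ℕ Mat
reduce zero M = zero , M
reduce (suc k) M with mindex M
... | nothing = suc k , M
... | just m with 1 <? rowsum M m
...   | yes _ =                                   -- (MA1)
  suc k , (λ i j → dec i j)
  where
  dec : Fin (suc k) → Fin (suc k) → ℕ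
  dec i j with i Fin.≟ m | toℕ j ≟ k
  ... | yes _ | yes _ = pred (M i j)
  ... | _     | _     = M i j
...   | no _ with toℕ m ≟ k
...     | yes _ = k , (λ i j → M (inject₁ i) (inject₁ j))   -- (MA2)
...     | no _ = k , N                                       -- (MA3)
  where
  N : Fin k → Fin k → ℕ
  N i j with toℕ (punchIn m j) ≟ k | toℕ (punchIn m i) <? toℕ m
  ... | yes _ | yes _ = M (punchIn m i) m
  ... | _     | _     = M (punchIn m i) (punchIn m j)

-- a_k = mindex(M^(k)) - 1, i.e. the 0-based mindex
aVal : ∀ {d} → Mat d → ℕ
aVal M with mindex M
... | just m = toℕ m
... | nothing = 0

fSeq : ℕ → (d : ℕ) → Mat d → List ℕ
fSeq zero d M = []
fSeq (suc n) d M with reduce d M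
... | d' , M' = fSeq n d' M' ++ [ aVal M ]

fMA : (n d : ℕ) → Mat d → List ℕ
fMA n d M = fSeq n d M

colBlock : ∀ {d} → Mat d → Fin d → List ℕ
colBlock {d} M j =
  concatMap (λ i → replicate (M i j) (toℕ i))
            (filter (λ i → toℕ i ≤? toℕ j) (reverse (allFin d)))

rhs : ∀ {d} → Mat d → List ℕ
rhs {d} M = concatMap (colBlock M) (allFin d)

-- The diagonal entry in the last column of an R-matrix is positive, so mindex always exists and
-- rule (MA3) never fires.  If row mindex sums to more than 1, (MA1) removes one unit from the last
-- column in the topmost occupied row m; that is the last letter m of the last column block.  If it
-- sums to 1, the row must be the last one (a higher row would hold its diagonal entry as well), so
-- the last column is zero except for a 1 on the diagonal and (MA2) deletes the one-letter block d-1.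
-- Either way reduce yields an R-matrix of size n-1 whose word is the old one without its last
-- letter a_n, and induction on n finishes.
module Submission where

open import Defs
open import Data.Nat using (ℕ; zero; suc; _+_; _<_; _≤_; _≟_; _<?_; _≤?_; pred; s≤s; z<s; s<s⁻¹; >-nonZero)
open import Data.Nat.Properties
  using (+-0-commutativeMonoid; m≤m+n; +-monoʳ-≤; +-mono-≤; +-comm; ≤-trans; ≤-reflexive; <-≤-trans;
         ≤-antisym; <⇒≢; ≰⇒>; ≮⇒≥; n≮0; 0≢1+n; suc-injective; suc-pred)
open import Data.Nat.ListAction using (sum)
open import Algebra.Properties.CommutativeMonoid.Sum +-0-commutativeMonoid
  using (sum-cong-≗; sum-init-last; sum-remove; sum-replicate-zero)
  renaming (sum to ∑)
open import Data.Fin as Fin using (Fin; toℕ; inject₁; fromℕ; punchIn; punchOut)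
open import Data.Fin.Properties
  using (toℕ-fromℕ; toℕ-inject₁; toℕ-injective; ≤fromℕ; fromℕ≢inject₁; punchInᵢ≢i; punchIn-punchOut)
  renaming (≤∧≢⇒< to ≤∧≢⇒<ᶠ; <⇒≢ to <⇒≢ᶠ; suc-injective to suc-injectiveᶠ)
open import Data.List
  using (List; []; _∷_; _++_; [_]; map; concat; concatMap; replicate; filter; reverse; tabulate; allFin)
open import Data.List.Properties
  using (map-tabulate; tabulate-cong; concatMap-++; ++-identityʳ; ++-assoc; unfold-reverse; reverse-++)
open import Data.Maybe using (just; nothing)
open import Data.Product using (∃-syntax; _,_; _×_; proj₁; proj₂)
open import Relation.Nullary using (yes; no; ¬_; contradiction)
open import Relation.Nullary.Decidable using (_×-dec_)
open import Relation.Unary using (Decidable)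
open import Relation.Binary.PropositionalEquality
  using (_≡_; _≢_; refl; sym; trans; cong; cong₂; subst; subst₂; module ≡-Reasoning)
open import Function using (_∘_; id)

open ≡-Reasoning

-- Finite sums

listSum-tabulate : ∀ {n} (f : Fin n → ℕ) → sum (tabulate f) ≡ ∑ f
listSum-tabulate {zero}  f = refl
listSum-tabulate {suc n} f = cong (f Fin.zero +_) (listSum-tabulate (f ∘ Fin.suc))

listSum-allFin : ∀ {n} (f : Fin n → ℕ) → sum (map f (allFin n)) ≡ ∑ f
listSum-allFin f = trans (cong sum (map-tabulate id f)) (listSum-tabulate f)

∑-zero : ∀ {n} {f : Fin n → ℕ} → (∀ i → f i ≡ 0) → ∑ f ≡ 0
∑-zero {n} f≡0 = trans (sum-cong-≗ f≡0) (sum-replicate-zero n)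

∑-suc-at : ∀ {n} {f g : Fin n → ℕ} p → f p ≡ suc (g p) → (∀ i → i ≢ p → f i ≡ g i) →
  ∑ f ≡ suc (∑ g)
∑-suc-at {suc n} {f} {g} p fp≡1+gp f≗g = begin
  ∑ f                            ≡⟨ sum-remove f ⟩
  f p + ∑ (f ∘ punchIn p)        ≡⟨ cong₂ _+_ fp≡1+gp (sum-cong-≗ λ i → f≗g _ (punchInᵢ≢i p i)) ⟩
  suc (g p + ∑ (g ∘ punchIn p))  ≡⟨ cong suc (sym (sum-remove g)) ⟩
  suc (∑ g)                      ∎

term≤∑ : ∀ {n} (f : Fin n → ℕ) i → f i ≤ ∑ f
term≤∑ {suc n} f i = ≤-trans (m≤m+n (f i) _) (≤-reflexive (sym (sum-remove f)))

two-terms≤∑ : ∀ {n} (f : Fin n → ℕ) {i j} → i ≢ j → f i + f j ≤ ∑ f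
two-terms≤∑ {suc n} f {i} {j} i≢j = ≤-trans
  (+-monoʳ-≤ (f i) (≤-trans (≤-reflexive (cong f (sym (punchIn-punchOut i≢j))))
                             (term≤∑ (f ∘ punchIn i) (punchOut i≢j))))
  (≤-reflexive (sym (sum-remove f)))

toℕ≡⇒≡fromℕ : ∀ {k} {j : Fin (suc k)} → toℕ j ≡ k → j ≡ fromℕ k
toℕ≡⇒≡fromℕ {k} toℕj≡k = toℕ-injective (trans toℕj≡k (sym (toℕ-fromℕ k)))

inject₁<fromℕ : ∀ {k} (j : Fin k) → inject₁ j Fin.< fromℕ k
inject₁<fromℕ j = ≤∧≢⇒<ᶠ (≤fromℕ (inject₁ j)) (fromℕ≢inject₁ ∘ sym)

UpperTriangular : ∀ {d} → Mat d → Set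
UpperTriangular M = ∀ i j → toℕ j < toℕ i → M i j ≡ 0

rowsum≡∑ : ∀ {d} (M : Mat d) i → rowsum M i ≡ ∑ (M i)
rowsum≡∑ M i = listSum-allFin (M i)

total≡∑∑ : ∀ {d} (M : Mat d) → total M ≡ ∑ (λ i → ∑ (M i))
total≡∑∑ M = trans (listSum-allFin (rowsum M)) (sum-cong-≗ (rowsum≡∑ M))

entry≤total : ∀ {d} (M : Mat d) i j → M i j ≤ total M
entry≤total M i j =
  ≤-trans (term≤∑ (M i) j) (≤-trans (term≤∑ (λ i → ∑ (M i)) i) (≤-reflexive (sym (total≡∑∑ M))))

upperTriangular⇒isRMatrix : ∀ {n d} {M : Mat d} →
  UpperTriangular M → total M ≡ n → (∀ i → 0 < M i i) → IsRMatrix n d M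
upperTriangular⇒isRMatrix {M = M} upper total≡n diag>0 = record
  { isMatrix = record
    { upper     = upper
    ; sumIs     = total≡n
    ; noZeroRow = λ i → positive-sum (M i) i (diag>0 i) ∘ trans (sym (rowsum≡∑ M i))
    ; noZeroCol = λ j → positive-sum (λ i → M i j) j (diag>0 j) ∘ trans (sym (listSum-allFin λ i → M i j))
    }
  ; diagPos  = diag>0
  }
  where
  positive-sum : ∀ {d} (f : Fin d → ℕ) i → 0 < f i → ∑ f ≢ 0
  positive-sum f i 0<fi ∑f≡0 = <⇒≢ (<-≤-trans 0<fi (term≤∑ f i)) (sym ∑f≡0)

isRMatrix⇒total>0 : ∀ {n k} {M : Mat (suc k)} → IsRMatrix n (suc k) M → 0 < n
isRMatrix⇒total>0 {M = M} r = subst (0 <_) (IsMatrix.sumIs (IsRMatrix.isMatrix r))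
  (<-≤-trans (IsRMatrix.diagPos r Fin.zero) (entry≤total M Fin.zero Fin.zero))

rowsum-last : ∀ {k} {M : Mat (suc k)} → UpperTriangular M → rowsum M (fromℕ k) ≡ M (fromℕ k) (fromℕ k)
rowsum-last {k} {M} upper = begin
  rowsum M (fromℕ k)
    ≡⟨ rowsum≡∑ M (fromℕ k) ⟩
  ∑ (M (fromℕ k))
    ≡⟨ sum-init-last (M (fromℕ k)) ⟩
  ∑ (M (fromℕ k) ∘ inject₁) + M (fromℕ k) (fromℕ k)
    ≡⟨ cong (_+ M (fromℕ k) (fromℕ k)) above-diagonal ⟩
  M (fromℕ k) (fromℕ k)
    ∎
  where
  above-diagonal : ∑ (M (fromℕ k) ∘ inject₁) ≡ 0
  above-diagonal = ∑-zero λ j → upper (fromℕ k) (inject₁ j) (inject₁<fromℕ j)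

record DecrementAt {d} (M M' : Mat d) (p q : Fin d) : Set where
  field
    decremented : M p q ≡ suc (M' p q)
    unchanged   : ∀ {i j} → ¬ (i ≡ p × j ≡ q) → M' i j ≡ M i j

total-decrementAt : ∀ {d} {M M' : Mat d} {p q} → DecrementAt M M' p q → total M ≡ suc (total M')
total-decrementAt {M = M} {M'} {p} {q} dec = begin
  total M                    ≡⟨ total≡∑∑ M ⟩
  ∑ (λ i → ∑ (M i))          ≡⟨ ∑-suc-at {f = λ i → ∑ (M i)} p row-p other-rows ⟩
  suc (∑ (λ i → ∑ (M' i)))   ≡⟨ cong suc (sym (total≡∑∑ M')) ⟩
  suc (total M')             ∎
  where
  open DecrementAt dec
  row-p : ∑ (M p) ≡ suc (∑ (M' p))
  row-p = ∑-suc-at q decremented λ j j≢q → sym (unchanged (j≢q ∘ proj₂))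
  other-rows : ∀ i → i ≢ p → ∑ (M i) ≡ ∑ (M' i)
  other-rows i i≢p = sum-cong-≗ λ j → sym (unchanged {i} {j} (i≢p ∘ proj₁))

dropLast : ∀ {k} → Mat (suc k) → Mat k
dropLast M i j = M (inject₁ i) (inject₁ j)

dropLast-upperTriangular : ∀ {k} {M : Mat (suc k)} → UpperTriangular M → UpperTriangular (dropLast M)
dropLast-upperTriangular upper i j j<i =
  upper (inject₁ i) (inject₁ j) (subst₂ _<_ (sym (toℕ-inject₁ j)) (sym (toℕ-inject₁ i)) j<i)

total-dropLast : ∀ {k} {M : Mat (suc k)} → UpperTriangular M → (∀ i → M (inject₁ i) (fromℕ k) ≡ 0) →
  total M ≡ total (dropLast M) + M (fromℕ k) (fromℕ k)
total-dropLast {k} {M} upper lastColumn≡0 = begin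
  total M
    ≡⟨ total≡∑∑ M ⟩
  ∑ (λ i → ∑ (M i))
    ≡⟨ sum-init-last (λ i → ∑ (M i)) ⟩
  ∑ (λ i → ∑ (M (inject₁ i))) + ∑ (M (fromℕ k))
    ≡⟨ cong₂ _+_ (sum-cong-≗ row-dropLast) (trans (sym (rowsum≡∑ M (fromℕ k))) (rowsum-last upper)) ⟩
  ∑ (λ i → ∑ (dropLast M i)) + M (fromℕ k) (fromℕ k)
    ≡⟨ cong (_+ M (fromℕ k) (fromℕ k)) (sym (total≡∑∑ (dropLast M))) ⟩
  total (dropLast M) + M (fromℕ k) (fromℕ k)
    ∎
  where
  row-dropLast : ∀ i → ∑ (M (inject₁ i)) ≡ ∑ (dropLast M i)
  row-dropLast i = trans (sum-init-last (M (inject₁ i)))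
                         (trans (cong (∑ (dropLast M i) +_) (lastColumn≡0 i)) (+-comm _ 0))

-- mindex and the rules (MA1), (MA2) of reduce

firstNZ-just : ∀ {n} (f : Fin n → ℕ) {m} → firstNZ f ≡ just m → 0 < f m × (∀ i → i Fin.< m → f i ≡ 0)
firstNZ-just {suc n} f eq with f Fin.zero in f0≡
firstNZ-just {suc n} f refl | suc _ = subst (0 <_) (sym f0≡) z<s , λ _ ()
firstNZ-just {suc n} f eq | zero with firstNZ (f ∘ Fin.suc) in eq′
firstNZ-just {suc n} f refl | zero | just m =
  proj₁ (firstNZ-just (f ∘ Fin.suc) eq′) , λ where
    Fin.zero    _         → f0≡
    (Fin.suc i) (s≤s i<m) → proj₂ (firstNZ-just (f ∘ Fin.suc) eq′) i i<m

firstNZ-nothing : ∀ {n} (f : Fin n → ℕ) → firstNZ f ≡ nothing → ∀ i → f i ≡ 0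
firstNZ-nothing {suc n} f eq i with f Fin.zero in f0≡
firstNZ-nothing {suc n} f () i | suc _
firstNZ-nothing {suc n} f eq i | zero with firstNZ (f ∘ Fin.suc) in eq′
firstNZ-nothing {suc n} f refl Fin.zero    | zero | nothing = f0≡
firstNZ-nothing {suc n} f refl (Fin.suc i) | zero | nothing = firstNZ-nothing (f ∘ Fin.suc) eq′ i

mindex-isJust : ∀ {k} (M : Mat (suc k)) → 0 < M (fromℕ k) (fromℕ k) → ∃[ m ] mindex M ≡ just m
mindex-isJust {k} M 0<Mkk with mindex M in eq
... | just m  = m , refl
... | nothing = contradiction (firstNZ-nothing (λ i → M i (fromℕ k)) eq (fromℕ k)) (<⇒≢ 0<Mkk ∘ sym)

mindex≡last : ∀ {n k} {M : Mat (suc k)} {m} → IsRMatrix n (suc k) M → mindex M ≡ just m →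
  ¬ 1 < rowsum M m → m ≡ fromℕ k
mindex≡last {k = k} {M} {m} r eq rowsum≤1 with m Fin.≟ fromℕ k
... | yes m≡last = m≡last
... | no  m≢last = contradiction
  (≤-trans (+-mono-≤ (IsRMatrix.diagPos r m) (proj₁ (firstNZ-just (λ i → M i (fromℕ k)) eq)))
           (≤-trans (two-terms≤∑ (M m) m≢last) (≤-reflexive (sym (rowsum≡∑ M m)))))
  rowsum≤1

aVal-mindex : ∀ {d} {M : Mat d} {m} → mindex M ≡ just m → aVal M ≡ toℕ m
aVal-mindex {M = M} eq with mindex M
aVal-mindex refl | just m = refl

fSeq-reduce : ∀ {n d d'} {M : Mat d} {M' : Mat d'} → reduce d M ≡ (d' , M') →
  fSeq (suc n) d M ≡ fSeq n d' M' ++ [ aVal M ]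
fSeq-reduce {d = d} {M = M} eq with reduce d M | eq
... | _ | refl = refl

reduce-MA1-dim : ∀ {k} {M : Mat (suc k)} {m} → mindex M ≡ just m → 1 < rowsum M m →
  ∃[ M' ] reduce (suc k) M ≡ (suc k , M')
reduce-MA1-dim {k} {M} {m} eq 1<rowsum with mindex M | eq
... | _ | refl with 1 <? rowsum M m
... | yes _       = _ , refl
... | no  rowsum≤1 = contradiction 1<rowsum rowsum≤1

reduce-MA1-entries : ∀ {k} {M M' : Mat (suc k)} {m} → mindex M ≡ just m → 1 < rowsum M m →
  reduce (suc k) M ≡ (suc k , M') → ∀ i j →
  (i ≡ m → toℕ j ≡ k → M' i j ≡ pred (M i j)) × (¬ (i ≡ m × toℕ j ≡ k) → M' i j ≡ M i j)
reduce-MA1-entries {k} {M} {M'} {m} eq 1<rowsum reduce≡ i j with mindex M | eq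
... | _ | refl with 1 <? rowsum M m
... | no rowsum≤1 = contradiction 1<rowsum rowsum≤1
... | yes _ with reduce≡
... | refl with i Fin.≟ m | toℕ j ≟ k
... | yes i≡m | yes j≡k = (λ _ _ → refl) , λ not-both → contradiction (i≡m , j≡k) not-both
... | yes _   | no  j≢k = (λ _ j≡k → contradiction j≡k j≢k) , λ _ → refl
... | no  i≢m | _       = (λ i≡m _ → contradiction i≡m i≢m) , λ _ → refl

reduce-MA1 : ∀ {k} {M : Mat (suc k)} {m} → mindex M ≡ just m → 1 < rowsum M m → 0 < M m (fromℕ k) →
  ∃[ M' ] reduce (suc k) M ≡ (suc k , M') × DecrementAt M M' m (fromℕ k)
reduce-MA1 {k} {M} {m} eq 1<rowsum 0<Mmk = M' , reduce≡ , record
  { decremented = trans (sym (suc-pred _ {{>-nonZero 0<Mmk}}))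
                        (cong suc (sym (proj₁ (entries m (fromℕ k)) refl (toℕ-fromℕ k))))
  ; unchanged   = λ {i} {j} not-both →
      proj₂ (entries i j) λ (i≡m , j≡k) → not-both (i≡m , toℕ≡⇒≡fromℕ j≡k)
  }
  where
  M' : Mat (suc k)
  M' = proj₁ (reduce-MA1-dim {M = M} eq 1<rowsum)
  reduce≡ : reduce (suc k) M ≡ (suc k , M')
  reduce≡ = proj₂ (reduce-MA1-dim {M = M} eq 1<rowsum)
  entries : ∀ i j → (i ≡ m → toℕ j ≡ k → M' i j ≡ pred (M i j)) ×
                    (¬ (i ≡ m × toℕ j ≡ k) → M' i j ≡ M i j)
  entries = reduce-MA1-entries {M = M} eq 1<rowsum reduce≡

reduce-MA2 : ∀ {k} {M : Mat (suc k)} {m} → mindex M ≡ just m → ¬ 1 < rowsum M m → toℕ m ≡ k →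
  reduce (suc k) M ≡ (k , dropLast M)
reduce-MA2 {k} {M} {m} eq rowsum≤1 m≡k with mindex M | eq
... | _ | refl with 1 <? rowsum M m
... | yes 1<rowsum = contradiction 1<rowsum rowsum≤1
... | no  _ with toℕ m ≟ k
... | yes _   = refl
... | no  m≢k = contradiction m≡k m≢k

-- The word rhs read column by column

concat-tabulate-init-last : ∀ {A : Set} {k} (f : Fin (suc k) → List A) →
  concat (tabulate f) ≡ concat (tabulate (f ∘ inject₁)) ++ f (fromℕ k)
concat-tabulate-init-last {k = zero}  f = ++-identityʳ (f Fin.zero)
concat-tabulate-init-last {k = suc k} f =
  trans (cong (f Fin.zero ++_) (concat-tabulate-init-last (f ∘ Fin.suc)))
        (sym (++-assoc (f Fin.zero) _ _))

replicates : ∀ {n} {A : Set} → (Fin n → ℕ) → (Fin n → A) → List A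
replicates c v = concat (tabulate λ i → replicate (c i) (v i))

replicates-cong : ∀ {n} {A : Set} {c c' : Fin n → ℕ} {v v' : Fin n → A} →
  (∀ i → c i ≡ c' i) → (∀ i → v i ≡ v' i) → replicates c v ≡ replicates c' v'
replicates-cong c≗c' v≗v' = cong concat (tabulate-cong λ i → cong₂ replicate (c≗c' i) (v≗v' i))

replicates-zero : ∀ {n} {A : Set} (v : Fin n → A) → replicates (λ _ → 0) v ≡ []
replicates-zero {zero}  v = refl
replicates-zero {suc n} v = replicates-zero (v ∘ Fin.suc)

replicates-decrement-first : ∀ {n} {A : Set} {c c' : Fin n → ℕ} (v : Fin n → A) p →
  (∀ i → i Fin.< p → c i ≡ 0) → c p ≡ suc (c' p) → (∀ i → i ≢ p → c i ≡ c' i) →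
  replicates c v ≡ v p ∷ replicates c' v
replicates-decrement-first {c = c} {c'} v Fin.zero _ c0≡1+c'0 c≗c' =
  cong₂ (λ x rest → replicate x (v Fin.zero) ++ rest) c0≡1+c'0
        (replicates-cong (λ i → c≗c' (Fin.suc i) λ ()) λ _ → refl)
replicates-decrement-first {c = c} {c'} v (Fin.suc p) above cp≡1+c'p c≗c' = begin
  replicate (c Fin.zero) (v Fin.zero) ++ replicates (c ∘ Fin.suc) (v ∘ Fin.suc)
    ≡⟨ cong (λ x → replicate x (v Fin.zero) ++ replicates (c ∘ Fin.suc) (v ∘ Fin.suc)) (above Fin.zero z<s) ⟩
  replicates (c ∘ Fin.suc) (v ∘ Fin.suc)
    ≡⟨ replicates-decrement-first (v ∘ Fin.suc) p (λ i i<p → above (Fin.suc i) (s≤s i<p)) cp≡1+c'p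
                                  (λ i i≢p → c≗c' (Fin.suc i) (i≢p ∘ suc-injectiveᶠ)) ⟩
  v (Fin.suc p) ∷ replicates (c' ∘ Fin.suc) (v ∘ Fin.suc)
    ≡⟨ cong (λ x → v (Fin.suc p) ∷ replicate x (v Fin.zero) ++ replicates (c' ∘ Fin.suc) (v ∘ Fin.suc))
            (trans (sym (above Fin.zero z<s)) (c≗c' Fin.zero λ ())) ⟩
  v (Fin.suc p) ∷ replicates c' v
    ∎

reverse-replicate : ∀ {A : Set} n (a : A) → reverse (replicate n a) ≡ replicate n a
reverse-replicate zero    a = refl
reverse-replicate (suc n) a = begin
  reverse (a ∷ replicate n a)     ≡⟨ unfold-reverse a (replicate n a) ⟩
  reverse (replicate n a) ++ [ a ] ≡⟨ cong (_++ [ a ]) (reverse-replicate n a) ⟩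
  replicate n a ++ [ a ]           ≡⟨ replicate-++-[] n ⟩
  a ∷ replicate n a                ∎
  where
  replicate-++-[] : ∀ n → replicate n a ++ [ a ] ≡ a ∷ replicate n a
  replicate-++-[] zero    = refl
  replicate-++-[] (suc n) = cong (a ∷_) (replicate-++-[] n)

concatMap-reverse : ∀ {A B : Set} (g : A → List B) → (∀ x → reverse (g x) ≡ g x) →
  ∀ xs → concatMap g (reverse xs) ≡ reverse (concatMap g xs)
concatMap-reverse g palindrome []       = refl
concatMap-reverse g palindrome (x ∷ xs) = begin
  concatMap g (reverse (x ∷ xs))                 ≡⟨ cong (concatMap g) (unfold-reverse x xs) ⟩
  concatMap g (reverse xs ++ [ x ])              ≡⟨ concatMap-++ g (reverse xs) [ x ] ⟩
  concatMap g (reverse xs) ++ (g x ++ [])        ≡⟨ cong₂ _++_ (concatMap-reverse g palindrome xs)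
                                                              (trans (++-identityʳ (g x)) (sym (palindrome x))) ⟩
  reverse (concatMap g xs) ++ reverse (g x)      ≡⟨ sym (reverse-++ (g x) (concatMap g xs)) ⟩
  reverse (g x ++ concatMap g xs)                ∎

concatMap-filter : ∀ {A B : Set} {P : A → Set} (P? : Decidable P) (g : A → List B) →
  (∀ x → ¬ P x → g x ≡ []) → ∀ xs → concatMap g (filter P? xs) ≡ concatMap g xs
concatMap-filter P? g vanishes []       = refl
concatMap-filter P? g vanishes (x ∷ xs) with P? x
... | yes _  = cong (g x ++_) (concatMap-filter P? g vanishes xs)
... | no ¬Px = trans (concatMap-filter P? g vanishes xs) (cong (_++ concatMap g xs) (sym (vanishes x ¬Px)))

-- Read top-down, so that the topmost nonzero row, where (MA1) acts, gives the first letter.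
column : ∀ {d} → Mat d → Fin d → List ℕ
column M j = replicates (λ i → M i j) toℕ

colBlock≡reverse-column : ∀ {d} {M : Mat d} → UpperTriangular M → ∀ j → colBlock M j ≡ reverse (column M j)
colBlock≡reverse-column {d} {M} upper j = begin
  concatMap letters (filter (λ i → toℕ i ≤? toℕ j) (reverse (allFin d)))
    ≡⟨ concatMap-filter (λ i → toℕ i ≤? toℕ j) letters
         (λ i i≰j → cong (λ x → replicate x (toℕ i)) (upper i j (≰⇒> i≰j))) (reverse (allFin d)) ⟩
  concatMap letters (reverse (allFin d))
    ≡⟨ concatMap-reverse letters (λ i → reverse-replicate (M i j) (toℕ i)) (allFin d) ⟩
  reverse (concatMap letters (allFin d))
    ≡⟨ cong (reverse ∘ concat) (map-tabulate id letters) ⟩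
  reverse (column M j)
    ∎
  where
  letters : Fin d → List ℕ
  letters i = replicate (M i j) (toℕ i)

rhs≡reverse-columns : ∀ {d} {M : Mat d} → UpperTriangular M → rhs M ≡ concat (tabulate (reverse ∘ column M))
rhs≡reverse-columns {M = M} upper =
  cong concat (trans (map-tabulate id (colBlock M)) (tabulate-cong (colBlock≡reverse-column upper)))

rhs-init-last : ∀ {k} {M : Mat (suc k)} → UpperTriangular M →
  rhs M ≡ concat (tabulate (reverse ∘ column M ∘ inject₁)) ++ reverse (column M (fromℕ k))
rhs-init-last {M = M} upper =
  trans (rhs≡reverse-columns upper) (concat-tabulate-init-last (reverse ∘ column M))

-- Rule (MA1) on R-matrices

decrementAt-last-upperTriangular : ∀ {k} {M M' : Mat (suc k)} {m} → UpperTriangular M →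
  DecrementAt M M' m (fromℕ k) → UpperTriangular M'
decrementAt-last-upperTriangular upper dec i j j<i =
  trans (DecrementAt.unchanged dec (<⇒≢ᶠ (<-≤-trans j<i (≤fromℕ i)) ∘ proj₂)) (upper i j j<i)

decrementAt-last-diagonal : ∀ {k} {M M' : Mat (suc k)} {m} → UpperTriangular M → (∀ i → 0 < M i i) →
  1 < rowsum M m → DecrementAt M M' m (fromℕ k) → ∀ i → 0 < M' i i
decrementAt-last-diagonal {k} {m = m} upper diag>0 1<rowsum dec i with (i Fin.≟ m) ×-dec (i Fin.≟ fromℕ k)
... | no  not-both    = subst (0 <_) (sym (DecrementAt.unchanged dec not-both)) (diag>0 i)
... | yes (refl , refl) =
  s<s⁻¹ (subst (1 <_) (trans (rowsum-last upper) (DecrementAt.decremented dec)) 1<rowsum)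

decrementAt-last-isRMatrix : ∀ {n k} {M M' : Mat (suc k)} {m} → IsRMatrix (suc n) (suc k) M →
  1 < rowsum M m → DecrementAt M M' m (fromℕ k) → IsRMatrix n (suc k) M'
decrementAt-last-isRMatrix r 1<rowsum dec = upperTriangular⇒isRMatrix
  (decrementAt-last-upperTriangular upper dec)
  (suc-injective (trans (sym (total-decrementAt dec)) sumIs))
  (decrementAt-last-diagonal upper diagPos 1<rowsum dec)
  where
  open IsRMatrix r
  open IsMatrix isMatrix

rhs-decrementAt-last : ∀ {k} {M M' : Mat (suc k)} {m} → UpperTriangular M →
  (∀ i → i Fin.< m → M i (fromℕ k) ≡ 0) → DecrementAt M M' m (fromℕ k) → rhs M ≡ rhs M' ++ [ toℕ m ]
rhs-decrementAt-last {k} {M} {M'} {m} upper above dec = begin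
  rhs M
    ≡⟨ rhs-init-last upper ⟩
  earlier M ++ reverse (column M (fromℕ k))
    ≡⟨ cong₂ _++_ earlier-columns (cong reverse last-column) ⟩
  earlier M' ++ reverse (toℕ m ∷ column M' (fromℕ k))
    ≡⟨ cong (earlier M' ++_) (unfold-reverse (toℕ m) (column M' (fromℕ k))) ⟩
  earlier M' ++ (reverse (column M' (fromℕ k)) ++ [ toℕ m ])
    ≡⟨ sym (++-assoc (earlier M') _ _) ⟩
  (earlier M' ++ reverse (column M' (fromℕ k))) ++ [ toℕ m ]
    ≡⟨ cong (_++ [ toℕ m ]) (sym (rhs-init-last (decrementAt-last-upperTriangular upper dec))) ⟩
  rhs M' ++ [ toℕ m ]
    ∎
  where
  open DecrementAt dec
  earlier : Mat (suc k) → List ℕ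
  earlier N = concat (tabulate (reverse ∘ column N ∘ inject₁))
  earlier-columns : earlier M ≡ earlier M'
  earlier-columns = cong concat (tabulate-cong λ j → cong reverse (column-unchanged j))
    where
    column-unchanged : ∀ j → column M (inject₁ j) ≡ column M' (inject₁ j)
    column-unchanged j =
      replicates-cong {v = toℕ} (λ i → sym (unchanged {i} {inject₁ j} (fromℕ≢inject₁ ∘ sym ∘ proj₂)))
                                λ _ → refl
  last-column : column M (fromℕ k) ≡ toℕ m ∷ column M' (fromℕ k)
  last-column = replicates-decrement-first toℕ m above decremented λ i i≢m → sym (unchanged (i≢m ∘ proj₁))

-- Rule (MA2) on R-matrices

dropLast-isRMatrix : ∀ {n k} {M : Mat (suc k)} → IsRMatrix (suc n) (suc k) M →
  (∀ i → i Fin.< fromℕ k → M i (fromℕ k) ≡ 0) → M (fromℕ k) (fromℕ k) ≡ 1 → IsRMatrix n k (dropLast M)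
dropLast-isRMatrix {n} {k} {M} r above Mkk≡1 =
  upperTriangular⇒isRMatrix (dropLast-upperTriangular upper) (suc-injective total≡1+n) (diagPos ∘ inject₁)
  where
  open IsRMatrix r
  open IsMatrix isMatrix
  total≡1+n : suc (total (dropLast M)) ≡ suc n
  total≡1+n = begin
    suc (total (dropLast M))                    ≡⟨ +-comm 1 _ ⟩
    total (dropLast M) + 1                      ≡⟨ cong (total (dropLast M) +_) (sym Mkk≡1) ⟩
    total (dropLast M) + M (fromℕ k) (fromℕ k)  ≡⟨ sym (total-dropLast upper (λ i → above _ (inject₁<fromℕ i))) ⟩
    total M                                     ≡⟨ sumIs ⟩
    suc n                                       ∎

rhs-dropLast : ∀ {k} {M : Mat (suc k)} → UpperTriangular M →
  (∀ i → i Fin.< fromℕ k → M i (fromℕ k) ≡ 0) → M (fromℕ k) (fromℕ k) ≡ 1 →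
  rhs M ≡ rhs (dropLast M) ++ [ k ]
rhs-dropLast {k} {M} upper above Mkk≡1 = begin
  rhs M                                                          ≡⟨ rhs-init-last upper ⟩
  concat (tabulate (reverse ∘ column M ∘ inject₁)) ++ reverse (column M (fromℕ k))
    ≡⟨ cong₂ _++_ (cong concat (tabulate-cong (cong reverse ∘ column-dropLast))) (cong reverse last-column) ⟩
  concat (tabulate (reverse ∘ column (dropLast M))) ++ [ toℕ (fromℕ k) ]
    ≡⟨ cong₂ _++_ (sym (rhs≡reverse-columns (dropLast-upperTriangular upper))) (cong [_] (toℕ-fromℕ k)) ⟩
  rhs (dropLast M) ++ [ k ]                                      ∎
  where
  column-dropLast : ∀ j → column M (inject₁ j) ≡ column (dropLast M) j
  column-dropLast j = begin
    column M (inject₁ j)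
      ≡⟨ concat-tabulate-init-last (λ i → replicate (M i (inject₁ j)) (toℕ i)) ⟩
    upper-part ++ replicate (M (fromℕ k) (inject₁ j)) (toℕ (fromℕ k))
      ≡⟨ cong (λ x → upper-part ++ replicate x (toℕ (fromℕ k))) (upper _ _ (inject₁<fromℕ j)) ⟩
    upper-part ++ []
      ≡⟨ ++-identityʳ upper-part ⟩
    upper-part
      ≡⟨ replicates-cong {c = λ i → dropLast M i j} (λ _ → refl) toℕ-inject₁ ⟩
    column (dropLast M) j
      ∎
    where
    upper-part : List ℕ
    upper-part = replicates (λ i → M (inject₁ i) (inject₁ j)) (toℕ ∘ inject₁)
  last-column : column M (fromℕ k) ≡ [ toℕ (fromℕ k) ]
  last-column = trans
    (replicates-decrement-first {c' = λ _ → 0} toℕ (fromℕ k) above Mkk≡1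
                                (λ i i≢k → above i (≤∧≢⇒<ᶠ (≤fromℕ i) i≢k)))
    (cong (toℕ (fromℕ k) ∷_) (replicates-zero (toℕ {suc k})))

record Reduction (n d : ℕ) (M : Mat d) : Set where
  field
    dim       : ℕ
    reduced   : Mat dim
    reduces   : reduce d M ≡ (dim , reduced)
    isRMatrix : IsRMatrix n dim reduced
    rhs-snoc  : rhs M ≡ rhs reduced ++ [ aVal M ]

reduction-MA1 : ∀ {n k} {M : Mat (suc k)} {m} → IsRMatrix (suc n) (suc k) M → mindex M ≡ just m →
  1 < rowsum M m → Reduction n (suc k) M
reduction-MA1 {k = k} {M} r eq 1<rowsum with firstNZ-just (λ i → M i (fromℕ k)) eq
... | 0<Mmk , above with reduce-MA1 eq 1<rowsum 0<Mmk
... | M' , reduce≡ , dec = record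
  { dim       = suc k
  ; reduced   = M'
  ; reduces   = reduce≡
  ; isRMatrix = decrementAt-last-isRMatrix r 1<rowsum dec
  ; rhs-snoc  = trans (rhs-decrementAt-last (IsMatrix.upper (IsRMatrix.isMatrix r)) above dec)
                      (cong (λ a → rhs M' ++ [ a ]) (sym (aVal-mindex {M = M} eq)))
  }

reduction-MA2 : ∀ {n k} {M : Mat (suc k)} → IsRMatrix (suc n) (suc k) M → mindex M ≡ just (fromℕ k) →
  ¬ 1 < rowsum M (fromℕ k) → Reduction n (suc k) M
reduction-MA2 {k = k} {M} r eq rowsum≤1 = record
  { dim       = k
  ; reduced   = dropLast M
  ; reduces   = reduce-MA2 {M = M} eq rowsum≤1 (toℕ-fromℕ k)
  ; isRMatrix = dropLast-isRMatrix r above Mkk≡1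
  ; rhs-snoc  = trans (rhs-dropLast upper above Mkk≡1)
                      (cong (λ a → rhs (dropLast M) ++ [ a ]) (sym (trans (aVal-mindex {M = M} eq) (toℕ-fromℕ k))))
  }
  where
  upper : UpperTriangular M
  upper = IsMatrix.upper (IsRMatrix.isMatrix r)
  above : ∀ i → i Fin.< fromℕ k → M i (fromℕ k) ≡ 0
  above = proj₂ (firstNZ-just (λ i → M i (fromℕ k)) eq)
  Mkk≡1 : M (fromℕ k) (fromℕ k) ≡ 1
  Mkk≡1 = ≤-antisym (subst (_≤ 1) (rowsum-last upper) (≮⇒≥ rowsum≤1)) (IsRMatrix.diagPos r (fromℕ k))

reduce-isRMatrix : ∀ {n k} {M : Mat (suc k)} → IsRMatrix (suc n) (suc k) M → Reduction n (suc k) M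
reduce-isRMatrix {k = k} {M} r with mindex-isJust M (IsRMatrix.diagPos r (fromℕ k))
... | m , eq with 1 <? rowsum M m
... | yes 1<rowsum = reduction-MA1 r eq 1<rowsum
... | no  rowsum≤1 with mindex≡last r eq rowsum≤1
... | refl = reduction-MA2 r eq rowsum≤1

lemma3p4 : (n d : ℕ) (M : Mat d) → IsRMatrix n d M → fMA n d M ≡ rhs M
lemma3p4 zero    zero    M r = refl
lemma3p4 zero    (suc k) M r = contradiction (isRMatrix⇒total>0 r) n≮0
lemma3p4 (suc n) zero    M r = contradiction (IsMatrix.sumIs (IsRMatrix.isMatrix r)) 0≢1+n
lemma3p4 (suc n) (suc k) M r = begin
  fSeq (suc n) (suc k) M           ≡⟨ fSeq-reduce {n = n} {M = M} reduces ⟩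
  fSeq n dim reduced ++ [ aVal M ] ≡⟨ cong (_++ [ aVal M ]) (lemma3p4 n dim reduced isRMatrix) ⟩
  rhs reduced ++ [ aVal M ]        ≡⟨ sym rhs-snoc ⟩
  rhs M                            ∎
  where open Reduction (reduce-isRMatrix r)
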